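{- Let $t$ be a positive integer. For all integers $n$ and $k$, the number of $t$-admissible $(n,k)$-NE-paths equals the number of $t$-admissible $(n,k)$-columnar tableaux.
   Context: An NE-path from $(x_1,y_1)$ to $(x_2,y_2)$ is a continuous path in the plane from $(x_1,y_1)$ to $(x_2,y_2)$ consisting of finitely many unit steps, each in the north or east direction. An $(n,k)$-NE-path is an NE-path from $(0,0)$ to $(k,n-k)$; it is $t$-admissible if it does not intersect the line $y=x-t$. An $(n,k)$-columnar tableau is a strictly increasing $k$-tuple of integers $T=(T_1,\dots,T_k)$ with $\{T_1,\dots,T_k\}\subseteq\{1,\dots,n\}$; it is $t$-admissible if, whenever $t-1<k$, one has $t-1+2j\le T_{t-1+j}$ for every $j\in\{1,\dots,k-t+1\}$. -}

module Defs where

open import Data.Nat using (ℕ; zero; suc; _+_; _*_; _∸_; _≡ᵇ_; _≤ᵇ_; _<ᵇ_)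
open import Data.Bool using (Bool; true; false; not; _∧_; if_then_else_)
open import Data.List using (List; []; _∷_; length; filter; map; concatMap; upTo)
open import Data.Vec using (Vec; []; _∷_)
open import Relation.Nullary.Decidable using (Dec; yes; no)
open import Relation.Binary.PropositionalEquality using (_≡_; refl)
open import Data.Bool.Properties using (_≟_)

allB : {A : Set} → (A → Bool) → List A → Bool
allB p []       = true
allB p (x ∷ xs) = p x ∧ allB p xs

countB : {A : Set} → (A → Bool) → List A → ℕ
countB p xs = length (filter (λ x → p x ≟ true) xs)

allVecs : {A : Set} → List A → (m : ℕ) → List (Vec A m)
allVecs xs zero    = [] ∷ []
allVecs xs (suc m) = concatMap (λ x → map (x ∷_) (allVecs xs m)) xs

oneTo : ℕ → List ℕ
oneTo n = map suc (upTo n)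

data Step : Set where
  N E : Step

allSteps : List Step
allSteps = N ∷ E ∷ []

numE : {m : ℕ} → Vec Step m → ℕ
numE []       = 0
numE (N ∷ ps) = numE ps
numE (E ∷ ps) = suc (numE ps)

-- an NE-path from (0,0) with n steps ends at (numE p, n - numE p).
-- It is an (n,k)-NE-path iff numE p = k (then it ends at (k, n-k)).
endsAtB : {n : ℕ} → ℕ → Vec Step n → Bool
endsAtB k p = numE p ≡ᵇ k

-- A lattice point (x,y) lies on the line y = x - t  iff  x = y + t.
onLineB : ℕ → ℕ → ℕ → Bool
onLineB t x y = x ≡ᵇ y + t

-- Starting at lattice point (x,y), the path avoids the line y = x - t:
-- checks every lattice point visited after (x,y).
avoidsFrom : ℕ → ℕ → ℕ → {m : ℕ} → Vec Step m → Bool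
avoidsFrom t x y []       = true
avoidsFrom t x y (N ∷ ps) = not (onLineB t x (suc y)) ∧ avoidsFrom t x (suc y) ps
avoidsFrom t x y (E ∷ ps) = not (onLineB t (suc x) y) ∧ avoidsFrom t (suc x) y ps

-- t-admissible: no visited lattice point (including the origin) is on y = x - t.
-- (Since t is an integer, a unit N/E segment meets this line iff one of its
-- lattice endpoints does, so this is exactly "does not intersect the line".)
admissiblePathB : ℕ → {n : ℕ} → Vec Step n → Bool
admissiblePathB t p = not (onLineB t 0 0) ∧ avoidsFrom t 0 0 p

numAdmissiblePaths : ℕ → ℕ → ℕ → ℕ
numAdmissiblePaths t n k =
  countB (λ p → endsAtB k p ∧ admissiblePathB t p) (allVecs allSteps n)

-- Columnar tableaux: T = (T_1,...,T_k), entries in {1..n}, strictly increasing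

strictlyIncB : {m : ℕ} → Vec ℕ m → Bool
strictlyIncB []           = true
strictlyIncB (a ∷ [])     = true
strictlyIncB (a ∷ b ∷ xs) = (a <ᵇ b) ∧ strictlyIncB (b ∷ xs)

-- 1-based entry T_i (default 0 out of range; never used out of range below)
entry : {m : ℕ} → Vec ℕ m → ℕ → ℕ
entry []       i             = 0
entry (a ∷ xs) zero          = 0
entry (a ∷ xs) (suc zero)    = a
entry (a ∷ xs) (suc (suc i)) = entry xs (suc i)

admissibleTableauB : ℕ → {k : ℕ} → Vec ℕ k → Bool
admissibleTableauB t {k} T =
  if (t ∸ 1) <ᵇ k
  then allB (λ j → ((t ∸ 1) + 2 * j) ≤ᵇ entry T ((t ∸ 1) + j)) (oneTo (k + 1 ∸ t))
  else true

numAdmissibleTableaux : ℕ → ℕ → ℕ → ℕ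
numAdmissibleTableaux t n k =
  countB (λ T → strictlyIncB T ∧ admissibleTableauB t T) (allVecs (oneTo n) k)

module Submission where

-- Both numbers are values of one four-argument recurrence.  Carry a budget s
-- (initially t, raised by one with every step / every lowering of the entries)
-- and the number i of east steps taken / tableau entries consumed so far; call
-- the (i+1)-th step or entry, of value a, clear if 2(i+1) < a + s.
--   * Paths: an east step (a = 1) is allowed iff it is clear; splitting on the
--     first step gives P(s,i,n+1,k+1) = [clear]·P(s+1,i+1,n,k) + P(s+1,i,n,k+1).
--   * Tableaux: every entry must be clear.  Splitting on whether the first entry
--     is 1 (it is consumed) or not (all entries drop by one, the budget rises by
--     one) gives the same recurrence.
-- Both sides are 1 for k = 0 and 0 for n = 0 < k, hence equal.

open import Defs
open import Data.Bool using (Bool; true; false; not; _∧_; if_then_else_; T)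
open import Data.Bool.Properties using (T-∧; ∧-zeroʳ)
open import Data.Empty using (⊥-elim)
open import Data.List using (List; []; _∷_; _++_; map; concatMap; upTo)
open import Data.Nat.ListAction using (sum)
open import Data.List.Properties using (map-∘; map-cong; map-applyUpTo)
open import Data.List.Relation.Unary.All using (All; []; _∷_)
import Data.List.Relation.Unary.All.Properties as All
open import Data.Nat using (ℕ; zero; suc; _+_; _*_; _∸_; _≡ᵇ_; _≤ᵇ_; _<ᵇ_;
  _≤_; _<_; s≤s; s≤s⁻¹; s<s⁻¹; z<s; _<?_)
open import Data.Nat.Properties using (+-assoc; +-comm; +-suc; +-identityʳ; +-mono-≤;
  +-monoʳ-≤; +-monoˡ-≤; ≤-<-trans; +-cancelˡ-≤; +-cancelʳ-≤; ≤⇒≤ᵇ; ≤ᵇ⇒≤; <⇒<ᵇ; <ᵇ⇒<;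
  ≡ᵇ⇒≡; ≡⇒≡ᵇ; <⇒≢; ≤∧≢⇒<; ≮⇒≥; <⇒≤; n<1+n; m≤n⇒m≤1+n; m≤n⇒m∸n≡0;
  m∸n≢0⇒n<m; m+n≤o⇒m≤o∸n; m≤o∸n⇒m+n≤o; m≤n⇒∃[o]m+o≡n; module ≤-Reasoning)
open import Data.Nat.Tactic.RingSolver using (solve-∀)
open import Data.Product using (_,_)
open import Data.Vec using (Vec; []; _∷_) renaming (map to vmap)
open import Function using (_∘_; _⇔_; mk⇔; Equivalence)
open import Relation.Nullary using (yes; no; ¬_)
open import Relation.Binary.PropositionalEquality using (_≡_; _≢_; refl; sym;
  trans; cong; cong₂; subst; module ≡-Reasoning)

open Equivalence using (to; from)

T-ext : {a b : Bool} → (T a → T b) → (T b → T a) → a ≡ b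
T-ext {false} {false} _ _ = refl
T-ext {false} {true}  _ g = ⊥-elim (g _)
T-ext {true}  {false} f _ = ⊥-elim (f _)
T-ext {true}  {true}  _ _ = refl

T-not : {b : Bool} → T (not b) → ¬ T b
T-not {true} ()

≡ᵇ-false : {m n : ℕ} → m ≢ n → (m ≡ᵇ n) ≡ false
≡ᵇ-false m≢n = T-ext (λ h → m≢n (≡ᵇ⇒≡ _ _ h)) (λ ())

∧-cong-under : (c : Bool) {a b : Bool} → (T c → a ≡ b) → (c ∧ a) ≡ (c ∧ b)
∧-cong-under false _ = refl
∧-cong-under true  h = h _

∧-interchange : (x y z w : Bool) → (x ∧ (y ∧ (z ∧ w))) ≡ ((x ∧ z) ∧ (y ∧ w))
∧-interchange true  y true  w = refl
∧-interchange true  y false w = ∧-zeroʳ y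
∧-interchange false y z     w = refl

allB-All : {A : Set} (p : A → Bool) (xs : List A) → T (allB p xs) ⇔ All (T ∘ p) xs
allB-All p []       = mk⇔ (λ _ → []) (λ _ → _)
allB-All p (x ∷ xs) = mk⇔
  (λ h → let px , rest = to T-∧ h in px ∷ to (allB-All p xs) rest)
  (λ { (px ∷ rest) → from T-∧ (px , from (allB-All p xs) rest) })

allB-oneTo : (p : ℕ → Bool) (m : ℕ) →
  T (allB p (oneTo m)) ⇔ (∀ {j} → j < m → T (p (suc j)))
allB-oneTo p m = mk⇔ every pass
  where
  every : T (allB p (oneTo m)) → ∀ {j} → j < m → T (p (suc j))
  every h = All.applyUpTo⁻ (λ j → j) m (All.map⁻ (to (allB-All p (oneTo m)) h))
  pass : (∀ {j} → j < m → T (p (suc j))) → T (allB p (oneTo m))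
  pass h = from (allB-All p (oneTo m)) (All.map⁺ (All.applyUpTo⁺₁ (λ j → j) m h))

count : {A : Set} → (A → Bool) → List A → ℕ
count p []       = 0
count p (x ∷ xs) = (if p x then 1 else 0) + count p xs

countB≡count : {A : Set} (p : A → Bool) (xs : List A) → countB p xs ≡ count p xs
countB≡count p []       = refl
countB≡count p (x ∷ xs) with p x
... | true  = cong suc (countB≡count p xs)
... | false = countB≡count p xs

count-++ : {A : Set} (p : A → Bool) (xs ys : List A) →
  count p (xs ++ ys) ≡ count p xs + count p ys
count-++ p []       ys = refl
count-++ p (x ∷ xs) ys =
  trans (cong ((if p x then 1 else 0) +_) (count-++ p xs ys))
        (sym (+-assoc (if p x then 1 else 0) (count p xs) (count p ys)))

count-map : {A B : Set} (p : B → Bool) (f : A → B) (xs : List A) →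
  count p (map f xs) ≡ count (p ∘ f) xs
count-map p f []       = refl
count-map p f (x ∷ xs) = cong ((if p (f x) then 1 else 0) +_) (count-map p f xs)

count-concatMap : {A B : Set} (p : B → Bool) (f : A → List B) (xs : List A) →
  count p (concatMap f xs) ≡ sum (map (count p ∘ f) xs)
count-concatMap p f []       = refl
count-concatMap p f (x ∷ xs) =
  trans (count-++ p (f x) (concatMap f xs)) (cong (count p (f x) +_) (count-concatMap p f xs))

count-cong : {A : Set} {p q : A → Bool} → (∀ x → p x ≡ q x) → (xs : List A) →
  count p xs ≡ count q xs
count-cong h []       = refl
count-cong h (x ∷ xs) = cong₂ _+_ (cong (λ b → if b then 1 else 0) (h x)) (count-cong h xs)

count-false : {A : Set} (xs : List A) → count (λ _ → false) xs ≡ 0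
count-false []       = refl
count-false (x ∷ xs) = count-false xs

count-guard : {A : Set} (e : A → Bool) (c : Bool) (r : A → Bool) (xs : List A) →
  count (λ x → e x ∧ (c ∧ r x)) xs ≡ (if c then count (λ x → e x ∧ r x) xs else 0)
count-guard e true  r xs = refl
count-guard e false r xs = trans (count-cong (λ x → ∧-zeroʳ (e x)) xs) (count-false xs)

count-∧-cong : {A B : Set} {c c′ : Bool} {q : A → Bool} {q′ : B → Bool}
  (xs : List A) (ys : List B) → c ≡ c′ → count q xs ≡ count q′ ys →
  count (λ x → c ∧ q x) xs ≡ count (λ y → c′ ∧ q′ y) ys
count-∧-cong {c = true}  xs ys refl eq = eq
count-∧-cong {c = false} xs ys refl eq = trans (count-false xs) (sym (count-false ys))

count-allVecs-suc : {A : Set} (L : List A) (k : ℕ) (p : Vec A (suc k) → Bool) →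
  count p (allVecs L (suc k)) ≡ sum (map (λ a → count (λ v → p (a ∷ v)) (allVecs L k)) L)
count-allVecs-suc L k p =
  trans (count-concatMap p (λ a → map (a ∷_) (allVecs L k)) L)
        (cong sum (map-cong (λ a → count-map p (a ∷_) (allVecs L k)) L))

count-by-head : {A : Set} (x : A) (f : A → A) (L : List A) (k : ℕ)
  (p : Vec A (suc k) → Bool) →
  count p (allVecs (x ∷ map f L) (suc k)) ≡
    count (λ v → p (x ∷ v)) (allVecs (x ∷ map f L) k) +
    sum (map (λ a → count (λ v → p (f a ∷ v)) (allVecs (x ∷ map f L) k)) L)
count-by-head x f L k p =
  trans (count-allVecs-suc (x ∷ map f L) k p)
        (cong (count (λ v → p (x ∷ v)) (allVecs (x ∷ map f L) k) +_) (cong sum (sym (map-∘ L))))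

count-allVecs-map : {A B : Set} (f : A → B) (L : List A) (k : ℕ) (p : Vec B k → Bool) →
  count p (allVecs (map f L) k) ≡ count (p ∘ vmap f) (allVecs L k)
count-allVecs-map f L zero    p = refl
count-allVecs-map f L (suc k) p =
  trans (count-allVecs-suc (map f L) k p)
  (trans (cong sum (sym (map-∘ L)))
  (trans (cong sum (map-cong (λ a → count-allVecs-map f L k (λ v → p (f a ∷ v))) L))
         (sym (count-allVecs-suc L k (p ∘ vmap f)))))

clears : ℕ → ℕ → ℕ → Bool
clears s i a = 2 * suc i <ᵇ a + s

clears-shift : ∀ s i a → clears s i (suc a) ≡ clears (suc s) i a
clears-shift s i a = cong (2 * suc i <ᵇ_) (sym (+-suc a s))

-- For the walker at (x, y) with m = y + t, an east step is clear iff it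
-- keeps the walker strictly left of the line: x + 1 < y + t.
east-clear⇔ : ∀ x m → T (clears (x + m) x 1) ⇔ suc x < m
east-clear⇔ x m = mk⇔
  (λ h → +-cancelˡ-≤ x _ _ (subst (_≤ x + m) (twice x) (s≤s⁻¹ (<ᵇ⇒< _ _ h))))
  (λ lt → <⇒<ᵇ (s≤s (subst (_≤ x + m) (sym (twice x)) (+-monoʳ-≤ x lt))))
  where
  twice : ∀ x → 2 * suc x ≡ x + suc (suc x)
  twice = solve-∀

-- The paper's condition u + 2j ≤ T_{u+j} is clearance of position u + j for
-- budget u + 1.
late-clear⇔ : ∀ u j e → T (u + 2 * suc j ≤ᵇ e) ⇔ T (clears (suc u) (u + j) e)
late-clear⇔ u j e = mk⇔
  (λ h → <⇒<ᵇ (subst (_≤ e + suc u) (sym (shift u j)) (+-monoˡ-≤ (suc u) (≤ᵇ⇒≤ _ _ h))))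
  (λ h → ≤⇒≤ᵇ (+-cancelʳ-≤ (suc u) _ _ (subst (_≤ e + suc u) (shift u j) (<ᵇ⇒< _ _ h))))
  where
  shift : ∀ u j → suc (2 * suc (u + j)) ≡ (u + 2 * suc j) + suc u
  shift = solve-∀

-- Positions up to u = t - 1 are clear for budget t as soon as T_j ≥ j.
early-clear : ∀ u m e → m < e → m < u → T (clears (suc u) m e)
early-clear u m e m<e m<u = <⇒<ᵇ (begin-strict
    2 * suc m       ≡⟨ cong (suc m +_) (+-identityʳ (suc m)) ⟩
    suc m + suc m   ≤⟨ +-mono-≤ m<e m<u ⟩
    e + u           <⟨ n<1+n (e + u) ⟩
    suc (e + u)     ≡⟨ sym (+-suc e u) ⟩
    e + suc u       ∎)
  where open ≤-Reasoning

pathOK : {m : ℕ} → ℕ → ℕ → Vec Step m → Bool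
pathOK s i []      = true
pathOK s i (N ∷ p) = pathOK (suc s) i p
pathOK s i (E ∷ p) = clears s i 1 ∧ pathOK (suc s) (suc i) p

Paths : ℕ → ℕ → ℕ → ℕ → ℕ
Paths s i n k = count (λ p → endsAtB k p ∧ pathOK s i p) (allVecs allSteps n)

-- Only the all-north path has no east step.
Paths-zero : ∀ s i n → Paths s i n 0 ≡ 1
Paths-zero s i zero    = refl
Paths-zero s i (suc n) =
  trans (count-allVecs-suc allSteps n (λ p → endsAtB 0 p ∧ pathOK s i p))
        (cong₂ _+_ (Paths-zero (suc s) i n) (cong (_+ 0) (count-false (allVecs allSteps n))))

Paths-suc : ∀ s i n k → Paths s i (suc n) (suc k) ≡
  (if clears s i 1 then Paths (suc s) (suc i) n k else 0) + Paths (suc s) i n (suc k)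
Paths-suc s i n k =
  trans (count-allVecs-suc allSteps n (λ p → endsAtB (suc k) p ∧ pathOK s i p))
  (trans (+-comm (Paths (suc s) i n (suc k)) _)
         (cong (_+ Paths (suc s) i n (suc k))
           (trans (+-identityʳ _)
                  (count-guard (endsAtB k) (clears s i 1) (pathOK (suc s) (suc i))
                               (allVecs allSteps n)))))

north-safe : ∀ {x m} → x < m → not (x ≡ᵇ suc m) ≡ true
north-safe x<m = cong not (≡ᵇ-false (<⇒≢ (m≤n⇒m≤1+n x<m)))

east-safe : ∀ {x m} → x < m → not (suc x ≡ᵇ m) ≡ clears (x + m) x 1
east-safe {x} {m} x<m = T-ext
  (λ ok → from (east-clear⇔ x m) (≤∧≢⇒< x<m (λ eq → T-not ok (≡⇒≡ᵇ (suc x) m eq))))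
  (λ c → subst (T ∘ not) (sym (≡ᵇ-false (<⇒≢ (to (east-clear⇔ x m) c)))) _)

avoidsFrom≡pathOK : ∀ {m} t x y (p : Vec Step m) → x < y + t →
  avoidsFrom t x y p ≡ pathOK (x + (y + t)) x p
avoidsFrom≡pathOK t x y []      _ = refl
avoidsFrom≡pathOK t x y (N ∷ p) h =
  trans (cong (_∧ avoidsFrom t x (suc y) p) (north-safe h))
  (trans (avoidsFrom≡pathOK t x (suc y) p (m≤n⇒m≤1+n h))
         (cong (λ s → pathOK s x p) (+-suc x (y + t))))
avoidsFrom≡pathOK t x y (E ∷ p) h =
  trans (cong (_∧ avoidsFrom t (suc x) y p) (east-safe h))
        (∧-cong-under (clears (x + (y + t)) x 1)
          (λ ok → avoidsFrom≡pathOK t (suc x) y p (to (east-clear⇔ x (y + t)) ok)))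

paths≡Paths : ∀ u n k → numAdmissiblePaths (suc u) n k ≡ Paths (suc u) 0 n k
paths≡Paths u n k =
  trans (countB≡count _ (allVecs allSteps n))
        (count-cong (λ p → cong (endsAtB k p ∧_) (avoidsFrom≡pathOK (suc u) 0 0 p z<s))
                    (allVecs allSteps n))

-- tabOK s b i v: the tuple v of 0-based entries is strictly increasing with
-- entries ≥ b, and its entries (read 1-based) are clear for budget s from
-- index i on.
tabOK : {m : ℕ} → ℕ → ℕ → ℕ → Vec ℕ m → Bool
tabOK s b i []      = true
tabOK s b i (a ∷ v) = (b ≤ᵇ a) ∧ (clears s i (suc a) ∧ tabOK s (suc a) (suc i) v)

Tabs : ℕ → ℕ → ℕ → ℕ → ℕ
Tabs s i n k = count (tabOK s 0 i) (allVecs (upTo n) k)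

upTo-suc : ∀ n → upTo (suc n) ≡ 0 ∷ map suc (upTo n)
upTo-suc n = cong (0 ∷_) (sym (map-applyUpTo (λ x → x) suc n))

≤ᵇ-suc : ∀ b a → (suc b ≤ᵇ suc a) ≡ (b ≤ᵇ a)
≤ᵇ-suc zero    a = refl
≤ᵇ-suc (suc b) a = refl

-- Tuples avoiding the value 0 correspond to tuples over L after lowering
-- every entry by one, which raises the budget by one.
lower-entries : ∀ s b i (L : List ℕ) k →
  count (tabOK s (suc b) i) (allVecs (0 ∷ map suc L) k) ≡ count (tabOK (suc s) b i) (allVecs L k)
lower-entries s b i L zero    = refl
lower-entries s b i L (suc k) =
  trans (count-by-head 0 suc L k (tabOK s (suc b) i))
  (trans (cong₂ _+_ (count-false V) (cong sum (map-cong lowered L)))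
         (sym (count-allVecs-suc L k (tabOK (suc s) b i))))
  where
  V : List (Vec ℕ k)
  V = allVecs (0 ∷ map suc L) k
  lowered : ∀ a → count (λ v → tabOK s (suc b) i (suc a ∷ v)) V ≡
                  count (λ v → tabOK (suc s) b i (a ∷ v)) (allVecs L k)
  lowered a = count-∧-cong V (allVecs L k) (≤ᵇ-suc b a)
                (count-∧-cong V (allVecs L k) (clears-shift s i (suc a))
                  (lower-entries s (suc a) (suc i) L k))

Tabs-suc : ∀ s i n k → Tabs s i (suc n) (suc k) ≡
  (if clears s i 1 then Tabs (suc s) (suc i) n k else 0) + Tabs (suc s) i n (suc k)
Tabs-suc s i n k =
  trans (cong (λ A → count (tabOK s 0 i) (allVecs A (suc k))) (upTo-suc n))
  (trans (count-by-head 0 suc L k (tabOK s 0 i))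
         (cong₂ _+_ first-is-least first-is-larger))
  where
  L : List ℕ
  L = upTo n
  V : List (Vec ℕ k)
  V = allVecs (0 ∷ map suc L) k
  first-is-least : count (λ v → tabOK s 0 i (0 ∷ v)) V ≡
                   (if clears s i 1 then Tabs (suc s) (suc i) n k else 0)
  first-is-least =
    trans (count-guard (λ _ → true) (clears s i 1) (tabOK s 1 (suc i)) V)
          (cong (λ c → if clears s i 1 then c else 0) (lower-entries s 0 (suc i) L k))
  first-is-larger : sum (map (λ a → count (λ v → tabOK s 0 i (suc a ∷ v)) V) L) ≡
                    Tabs (suc s) i n (suc k)
  first-is-larger =
    trans (sym (trans (count-by-head 0 suc L k (tabOK s 1 i))
                      (cong₂ _+_ (count-false V) refl)))
          (lower-entries s 0 i L (suc k))

increasing : {m : ℕ} → ℕ → Vec ℕ m → Bool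
increasing b []      = true
increasing b (a ∷ v) = (b ≤ᵇ a) ∧ increasing (suc a) v

bounded : {m : ℕ} → ℕ → ℕ → Vec ℕ m → Bool
bounded s i []      = true
bounded s i (a ∷ S) = clears s i a ∧ bounded s (suc i) S

tabOK-split : ∀ {m} s b i (v : Vec ℕ m) →
  tabOK s b i v ≡ (increasing b v ∧ bounded s i (vmap suc v))
tabOK-split s b i []      = refl
tabOK-split s b i (a ∷ v) =
  trans (cong (λ r → (b ≤ᵇ a) ∧ (clears s i (suc a) ∧ r)) (tabOK-split s (suc a) (suc i) v))
        (∧-interchange (b ≤ᵇ a) (clears s i (suc a)) (increasing (suc a) v) _)

strictlyIncB-suc : ∀ {m} (v : Vec ℕ m) → strictlyIncB (vmap suc v) ≡ increasing 0 v
strictlyIncB-suc []      = refl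
strictlyIncB-suc (a ∷ v) = from-head a v
  where
  from-head : ∀ {m} a (v : Vec ℕ m) → strictlyIncB (suc a ∷ vmap suc v) ≡ increasing (suc a) v
  from-head a []      = refl
  from-head a (c ∷ v) = cong ((a <ᵇ c) ∧_) (from-head c v)

increasing⇒large : ∀ {k} b (v : Vec ℕ k) → T (increasing b v) →
  ∀ {m} → m < k → b + m < entry (vmap suc v) (suc m)
increasing⇒large b (a ∷ v) h {m} m<k with to (T-∧ {b ≤ᵇ a}) h
increasing⇒large b (a ∷ v) h {zero}  _          | b≤a , _    =
  s≤s (subst (_≤ a) (sym (+-identityʳ b)) (≤ᵇ⇒≤ b a b≤a))
increasing⇒large b (a ∷ v) h {suc m} (s≤s m<k) | b≤a , rest =
  subst (_< entry (vmap suc v) (suc m)) (sym (+-suc b m))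
    (≤-<-trans (s≤s (+-monoˡ-≤ m (≤ᵇ⇒≤ b a b≤a))) (increasing⇒large (suc a) v rest m<k))

bounded-at : ∀ {k} s i (S : Vec ℕ k) →
  T (bounded s i S) ⇔ (∀ {m} → m < k → T (clears s (i + m) (entry S (suc m))))
bounded-at s i []      = mk⇔ (λ _ ()) (λ _ → _)
bounded-at s i (a ∷ S) = mk⇔
  (λ h → let c , rest = to T-∧ h in λ
    { {zero}  _   → subst (λ j → T (clears s j a)) (sym (+-identityʳ i)) c
    ; {suc m} m<k → subst (λ j → T (clears s j (entry S (suc m)))) (sym (+-suc i m))
                      (to (bounded-at s (suc i) S) rest (s<s⁻¹ m<k)) })
  (λ h → from T-∧
    ( subst (λ j → T (clears s j a)) (+-identityʳ i) (h z<s)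
    , from (bounded-at s (suc i) S)
        (λ {m} m<k → subst (λ j → T (clears s j (entry S (suc m)))) (+-suc i m) (h (s≤s m<k)))))

offset-range : ∀ u j k → (u + j < k) ⇔ (j < k ∸ u)
offset-range u j k = mk⇔
  (λ h → m+n≤o⇒m≤o∸n (suc j) (subst (_≤ k) (cong suc (+-comm u j)) h))
  (λ h → subst (_≤ k) (cong suc (+-comm j u))
           (m≤o∸n⇒m+n≤o (suc j) (<⇒≤ (m∸n≢0⇒n<m (λ eq → nonempty (subst (j <_) eq h)))) h))
  where
  nonempty : ¬ (j < 0)
  nonempty ()

check : ∀ {k} → ℕ → Vec ℕ k → ℕ → Bool
check u S j = u + 2 * j ≤ᵇ entry S (u + j)

admissible-range : ∀ u {k} (S : Vec ℕ k) →
  admissibleTableauB (suc u) S ≡ allB (check u S) (oneTo (k ∸ u))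
admissible-range u {k} S with u <ᵇ k in eq
... | true  = cong (λ z → allB (check u S) (oneTo (z ∸ suc u))) (+-comm k 1)
... | false = cong (λ z → allB (check u S) (oneTo z))
                (sym (m≤n⇒m∸n≡0 (≮⇒≥ (λ (u<k : u < k) → subst T eq (<⇒<ᵇ u<k)))))

admissible⇔bounded : ∀ u {k} (S : Vec ℕ k) → (∀ {m} → m < k → m < entry S (suc m)) →
  (∀ {j} → j < k ∸ u → T (check u S (suc j))) ⇔
  (∀ {m} → m < k → T (clears (suc u) m (entry S (suc m))))
admissible⇔bounded u {k} S large = mk⇔ forward backward
  where
  reindex : ∀ j → entry S (u + suc j) ≡ entry S (suc (u + j))
  reindex j = cong (entry S) (+-suc u j)
  forward : (∀ {j} → j < k ∸ u → T (check u S (suc j))) →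
            ∀ {m} → m < k → T (clears (suc u) m (entry S (suc m)))
  forward late {m} m<k with m <? u
  ... | yes m<u = early-clear u m _ (large m<k) m<u
  ... | no  m≮u with m≤n⇒∃[o]m+o≡n (≮⇒≥ m≮u)
  ...   | j , refl = to (late-clear⇔ u j _)
                       (subst (λ e → T (u + 2 * suc j ≤ᵇ e)) (reindex j)
                         (late (to (offset-range u j k) m<k)))
  backward : (∀ {m} → m < k → T (clears (suc u) m (entry S (suc m)))) →
             ∀ {j} → j < k ∸ u → T (check u S (suc j))
  backward all {j} j<k∸u =
    subst (λ e → T (u + 2 * suc j ≤ᵇ e)) (sym (reindex j))
      (from (late-clear⇔ u j _) (all (from (offset-range u j k) j<k∸u)))

admissible≡bounded : ∀ u {k} (S : Vec ℕ k) → (∀ {m} → m < k → m < entry S (suc m)) →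
  admissibleTableauB (suc u) S ≡ bounded (suc u) 0 S
admissible≡bounded u {k} S large = trans (admissible-range u S) (T-ext
  (λ h → from (bounded-at (suc u) 0 S) (to equiv (to (allB-oneTo (check u S) (k ∸ u)) h)))
  (λ h → from (allB-oneTo (check u S) (k ∸ u)) (from equiv (to (bounded-at (suc u) 0 S) h))))
  where
  equiv : (∀ {j} → j < k ∸ u → T (check u S (suc j))) ⇔
          (∀ {m} → m < k → T (clears (suc u) m (entry S (suc m))))
  equiv = admissible⇔bounded u S large

tableau-predicate : ∀ u {k} (v : Vec ℕ k) →
  (strictlyIncB (vmap suc v) ∧ admissibleTableauB (suc u) (vmap suc v)) ≡ tabOK (suc u) 0 0 v
tableau-predicate u v =
  trans (cong (_∧ admissibleTableauB (suc u) (vmap suc v)) (strictlyIncB-suc v))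
  (trans (∧-cong-under (increasing 0 v)
           (λ inc → admissible≡bounded u (vmap suc v) (increasing⇒large 0 v inc)))
         (sym (tabOK-split (suc u) 0 0 v)))

tableaux≡Tabs : ∀ u n k → numAdmissibleTableaux (suc u) n k ≡ Tabs (suc u) 0 n k
tableaux≡Tabs u n k =
  trans (countB≡count _ (allVecs (oneTo n) k))
  (trans (count-allVecs-map suc (upTo n) k (λ S → strictlyIncB S ∧ admissibleTableauB (suc u) S))
         (count-cong (tableau-predicate u) (allVecs (upTo n) k)))

Tabs≡Paths : ∀ n s i k → Tabs s i n k ≡ Paths s i n k
Tabs≡Paths n       s i zero    = sym (Paths-zero s i n)
Tabs≡Paths zero    s i (suc k) = refl
Tabs≡Paths (suc n) s i (suc k) =
  trans (Tabs-suc s i n k)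
  (trans (cong₂ _+_ (cong (λ c → if clears s i 1 then c else 0) (Tabs≡Paths n (suc s) (suc i) k))
                    (Tabs≡Paths n (suc s) i (suc k)))
         (sym (Paths-suc s i n k)))

lemma3p2 : (t : ℕ) → 1 ≤ t → (n k : ℕ) →
    numAdmissiblePaths t n k ≡ numAdmissibleTableaux t n k
lemma3p2 zero    ()
lemma3p2 (suc u) _ n k = begin
  numAdmissiblePaths (suc u) n k     ≡⟨ paths≡Paths u n k ⟩
  Paths (suc u) 0 n k                ≡⟨ sym (Tabs≡Paths n (suc u) 0 k) ⟩
  Tabs (suc u) 0 n k                 ≡⟨ sym (tableaux≡Tabs u n k) ⟩
  numAdmissibleTableaux (suc u) n k  ∎
  where open ≡-Reasoning
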